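{- Let $p$ be a prime and $\mathcal{O},\mathcal{O}'$ maximal orders of $B_p$. For any bound $b>0$, one has $\theta_{\mathcal{O}^T}(k)=\theta_{\mathcal{O}'^T}(k)$ for all positive integers $k\le b$ if and only if $\theta'_{\mathcal{O}^T}(k)=\theta'_{\mathcal{O}'^T}(k)$ for all positive integers $k\le b$.
   Context: $B_p$ is the quaternion algebra over $\mathbb{Q}$ ramified exactly at $p$ and $\infty$, with reduced trace $\mathrm{Tr}$ and reduced norm $\mathrm{Nr}$. A maximal order is a subring containing $\mathbb{Z}$, a $\mathbb{Z}$-lattice of rank $4$, not properly contained in another order. $\mathcal{O}^T := \{2a-\mathrm{Tr}(a) : a\in\mathcal{O}\}$. For a lattice $\Lambda=\langle v_1,\dots,v_n\rangle$ and $k\neq0$: $\theta_\Lambda(k)=\tfrac12\#\{(a_i)\in\mathbb{Z}^n : \mathrm{Nr}(\sum a_iv_i)=k\}$ and $\theta'_\Lambda(k)=\tfrac12\#\{(a_i)\in\mathbb{Z}^n : \mathrm{Nr}(\sum a_iv_i)=k,\ \gcd(a_1,\dots,a_n)=1\}$. -}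

module Defs where

open import Data.Nat as N using (ℕ; _%_; _≤_)
open import Data.Nat.GCD using (gcd)
open import Data.Nat.Primality using (Prime)
import Data.Integer as Z
import Data.Integer.Divisibility as Zd
open import Data.Integer using (ℤ; +_; ∣_∣)
open import Data.Rational as Q using (ℚ; _/_; 0ℚ; 1ℚ)
open import Data.Fin using (Fin)
open import Data.Vec using (Vec; []; _∷_; foldr; zipWith; lookup)
open import Data.Product using (Σ; _×_; ∃)
open import Function.Bundles using (_↔_; _⇔_)
open import Relation.Binary.PropositionalEquality using (_≡_)
open import Relation.Nullary using (¬_)

-- Quaternion algebra (a,b)_ℚ : basis 1,i,j,k with i²=a, j²=b, k=ij=-ji.

record Quat : Set where
  constructor quat
  field
    x₀ x₁ x₂ x₃ : ℚ
open Quat public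

ℤtoℚ : ℤ → ℚ
ℤtoℚ z = z / 1

ℕtoℚ : ℕ → ℚ
ℕtoℚ n = (+ n) / 1

module Algebra (a b : ℚ) where
  open Q using (_+_; _*_; _-_; -_)

  zeroQ : Quat
  zeroQ = quat 0ℚ 0ℚ 0ℚ 0ℚ

  oneQ : Quat
  oneQ = quat 1ℚ 0ℚ 0ℚ 0ℚ

  _⊕_ : Quat → Quat → Quat
  quat x0 x1 x2 x3 ⊕ quat y0 y1 y2 y3 = quat (x0 + y0) (x1 + y1) (x2 + y2) (x3 + y3)

  _⊗_ : Quat → Quat → Quat
  quat x0 x1 x2 x3 ⊗ quat y0 y1 y2 y3 = quat
    (x0 * y0 + a * x1 * y1 + b * x2 * y2 - a * b * x3 * y3)
    (x0 * y1 + x1 * y0 - b * x2 * y3 + b * x3 * y2)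
    (x0 * y2 + x2 * y0 + a * x1 * y3 - a * x3 * y1)
    (x0 * y3 + x3 * y0 + x1 * y2 - x2 * y1)

  _·_ : ℚ → Quat → Quat
  c · quat x0 x1 x2 x3 = quat (c * x0) (c * x1) (c * x2) (c * x3)

  scalar : ℚ → Quat
  scalar c = quat c 0ℚ 0ℚ 0ℚ

  Tr : Quat → ℚ
  Tr x = ℕtoℚ 2 * x₀ x

  Nr : Quat → ℚ
  Nr (quat x0 x1 x2 x3) = x0 * x0 - a * x1 * x1 - b * x2 * x2 + a * b * x3 * x3

  comb : ∀ {n} → Vec ℤ n → Vec Quat n → Quat
  comb c v = foldr _ _⊕_ zeroQ (zipWith (λ z w → ℤtoℚ z · w) c v)

  IsBasis : ∀ {n} → (Quat → Set) → Vec Quat n → Set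
  IsBasis {n} Λ v =
    (∀ x → Λ x ⇔ ∃ λ (c : Vec ℤ n) → comb c v ≡ x) ×
    (∀ (c : Vec ℤ n) → comb c v ≡ zeroQ → ∀ i → lookup c i ≡ + 0)

  -- an order: subring containing ℤ (i.e. containing 1, closed under
  -- multiplication; additive closure follows from being a lattice),
  -- which is a ℤ-lattice of rank 4
  IsOrder : (Quat → Set) → Set
  IsOrder O = O oneQ × (∀ x y → O x → O y → O (x ⊗ y)) ×
              Σ (Vec Quat 4) (λ e → IsBasis O e)

  IsMaximalOrder : (Quat → Set) → Set₁
  IsMaximalOrder O = IsOrder O ×
    (∀ (O' : Quat → Set) → IsOrder O' → (∀ x → O x → O' x) → ∀ x → O' x → O x)

  _ᵀ : (Quat → Set) → Quat → Set
  (O ᵀ) x = ∃ λ y → O y × ((ℕtoℚ 2 · y) ⊕ ((- 1ℚ) · scalar (Tr y))) ≡ x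

  Sol : ∀ {n} → Vec Quat n → ℕ → Set
  Sol {n} v k = Σ (Vec ℤ n) λ c → Nr (comb c v) ≡ ℕtoℚ k

  gcdVec : ∀ {n} → Vec ℤ n → ℕ
  gcdVec c = foldr _ (λ z g → gcd ∣ z ∣ g) 0 c

  SolPrim : ∀ {n} → Vec Quat n → ℕ → Set
  SolPrim {n} v k = Σ (Vec ℤ n) λ c → (Nr (comb c v) ≡ ℕtoℚ k) × (gcdVec c ≡ 1)

  -- θ_Λ(k) = m  (Λ = ⟨v⟩):  #{c : Nr(Σ cᵢvᵢ) = k} = 2m
  θ_≡_at_ : ∀ {n} → Vec Quat n → ℕ → ℕ → Set
  θ v ≡ m at k = Sol v k ↔ Fin (2 N.* m)

  θ'_≡_at_ : ∀ {n} → Vec Quat n → ℕ → ℕ → Set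
  θ' v ≡ m at k = SolPrim v k ↔ Fin (2 N.* m)

  θEq : ∀ {n} → Vec Quat n → Vec Quat n → ℕ → Set
  θEq v w k = ∃ λ m → (θ v ≡ m at k) × (θ w ≡ m at k)

  θ'Eq : ∀ {n} → Vec Quat n → Vec Quat n → ℕ → Set
  θ'Eq v w k = ∃ λ m → (θ' v ≡ m at k) × (θ' w ≡ m at k)

-- Standard presentations of B_p = (a,b)_ℚ, ramified exactly at p and ∞
-- (Pizer): p = 2 : (-1,-1);  p ≡ 3 mod 4 : (-1,-p);  p ≡ 5 mod 8 : (-2,-p);
-- p ≡ 1 mod 8 : (-p,-q) with q prime, q ≡ 3 mod 4, p not a square mod q.

data BpPresentation (p : ℕ) : ℚ → ℚ → Set where
  case2 : p ≡ 2 → BpPresentation p (Q.- 1ℚ) (Q.- 1ℚ)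
  case3mod4 : p % 4 ≡ 3 → BpPresentation p (Q.- 1ℚ) (Q.- ℕtoℚ p)
  case5mod8 : p % 8 ≡ 5 → BpPresentation p (Q.- ℕtoℚ 2) (Q.- ℕtoℚ p)
  case1mod8 : p % 8 ≡ 1 → (q : ℕ) → Prime q → q % 4 ≡ 3 →
              ¬ (∃ λ (x : ℤ) → (+ q) Zd.∣ (x Z.* x Z.- + p)) →
              BpPresentation p (Q.- ℕtoℚ p) (Q.- ℕtoℚ q)

{-# OPTIONS --safe #-}

-- A coefficient vector c ≠ 0 factors uniquely as c = d·c′ with d = gcd(c) and c′ primitive,
-- and Nr(Σ cᵢvᵢ) = d²·Nr(Σ c′ᵢvᵢ). As the norm form is integral on 𝒪ᵀ, this identifies the
-- solutions of Nr = k with the primitive solutions of Nr = k/d², d² ∣ k, for both lattices: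
-- θ(k) = Σ_{d²q=k} θ′(q). Summing gives one direction; for the other, θ′(k) is θ(k) minus the
-- terms with d ≥ 2, which only involve q < k, so strong induction on k applies.
-- Integrality: Nr(2y − Tr y) = 4 Nr y − (Tr y)², Tr y = Nr(1 + y) − 1 − Nr y, and Nr y ∈ ℤ for
-- y in an order because Nr(y)ⁿ = Nr(yⁿ) and the elements of an order have bounded denominators.

module Submission where

open import Defs
open import Data.Nat as ℕ using (ℕ; zero; suc; _≤_; _<_; _∸_; NonZero; z≤n; s≤s)
import Data.Nat.Properties as ℕ
open import Data.Nat.Divisibility using (_∣_; _∣?_; divides; ∣-refl; ∣-trans; ∣⇒≤)
open import Data.Nat.Coprimality as Coprime using (Coprime; coprime-divisor)
open import Data.Nat.GCD using (gcd; gcd[m,n]∣m; gcd[m,n]∣n; c*gcd[m,n]≡gcd[cm,cn])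
open import Data.Nat.Induction using (<-rec)
open import Data.Nat.Primality using (Prime)
open import Data.Integer as ℤ using (ℤ; +_; -[1+_])
import Data.Integer.Properties as ℤ
import Data.Integer.Divisibility.Signed as ℤ∣
import Data.Integer.Tactic.RingSolver as ℤ-Ring
open import Data.Rational as ℚ using (ℚ; mkℚ; 0ℚ; 1ℚ; _+_; _*_; _-_; -_; toℚᵘ)
import Data.Rational.Properties as ℚ
open import Data.Rational.Properties using (toℚᵘ-injective; toℚᵘ-fromℚᵘ; toℚᵘ-homo-+; toℚᵘ-homo-*; toℚᵘ-homo‿-; ↥p/↧p≡p; *-assoc; *-zeroʳ; *-distribˡ-+; *-1-commutativeMonoid)
import Data.Rational.Unnormalised as ℚᵘ
import Data.Rational.Unnormalised.Properties as ℚᵘ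
open import Data.Rational.Solver using (module +-*-Solver)
open import Algebra.Bundles using (CommutativeMonoid)
open import Algebra.Properties.CommutativeSemigroup (CommutativeMonoid.commutativeSemigroup *-1-commutativeMonoid) using (interchange; x∙yz≈y∙xz)
open import Algebra.Definitions.RawSemiring ℚ.+-*-rawSemiring using (_^_)
open import Algebra.Properties.Semiring.Sum ℕ.+-*-semiring using (sum; *-distribˡ-sum)
open import Data.Fin as Fin using (Fin; toℕ; fromℕ<)
import Data.Fin.Properties as Fin
open import Data.Vec using (Vec; []; _∷_; map; zipWith)
open import Data.Vec.Properties using (∷-injective)
open import Data.Vec.Relation.Unary.All as All using (All; []; _∷_)
open import Data.Sum using (_⊎_; inj₁; inj₂)
open import Data.Sum.Function.Propositional using (_⊎-↔_)
open import Data.Unit using (⊤; tt)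
open import Data.Empty using (⊥; ⊥-elim; ⊥-elim-irr)
open import Data.Product using (Σ; ∃; _×_; _,_; proj₁; proj₂)
open import Function.Base using (case_of_; _∘_)
open import Function.Bundles using (_↔_; _⇔_; Inverse; Equivalence; mk↔ₛ′)
open import Function.Properties.Inverse using (↔-refl; ↔-sym; ↔-trans; to-from)
open import Function.Related.TypeIsomorphisms using (⊎-assoc; ⊎-comm)
import Function.Related.Propositional as Related
open import Relation.Binary.PropositionalEquality
open import Relation.Nullary using (¬_; yes; no)
open import Axiom.UniquenessOfIdentityProofs using (module Decidable⇒UIP)

open +-*-Solver using (solve; _:=_; _:+_; _:*_; _:-_; con; Polynomial)

-- Integers inside ℚ and denominators

IsInt : ℚ → Set
IsInt q = ∃ λ z → q ≡ ℤtoℚ z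

toℚᵘ-ℤtoℚ : ∀ z → toℚᵘ (ℤtoℚ z) ℚᵘ.≃ ℚᵘ.mkℚᵘ z 0
toℚᵘ-ℤtoℚ z = toℚᵘ-fromℚᵘ (ℚᵘ.mkℚᵘ z 0)

ℤtoℚ-homo-+ : ∀ x y → ℤtoℚ (x ℤ.+ y) ≡ ℤtoℚ x + ℤtoℚ y
ℤtoℚ-homo-+ x y = toℚᵘ-injective (begin
  toℚᵘ (ℤtoℚ (x ℤ.+ y))             ≈⟨ toℚᵘ-ℤtoℚ (x ℤ.+ y) ⟩
  ℚᵘ.mkℚᵘ (x ℤ.+ y) 0               ≈⟨ ℚᵘ.*≡* (sum-over-1 x y) ⟩
  ℚᵘ.mkℚᵘ x 0 ℚᵘ.+ ℚᵘ.mkℚᵘ y 0      ≈⟨ ℚᵘ.+-cong (toℚᵘ-ℤtoℚ x) (toℚᵘ-ℤtoℚ y) ⟨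
  toℚᵘ (ℤtoℚ x) ℚᵘ.+ toℚᵘ (ℤtoℚ y)  ≈⟨ toℚᵘ-homo-+ (ℤtoℚ x) (ℤtoℚ y) ⟨
  toℚᵘ (ℤtoℚ x + ℤtoℚ y)            ∎)
  where
  open ℚᵘ.≃-Reasoning
  sum-over-1 : ∀ x y → (x ℤ.+ y) ℤ.* + 1 ≡ (x ℤ.* + 1 ℤ.+ y ℤ.* + 1) ℤ.* + 1
  sum-over-1 = ℤ-Ring.solve-∀

ℤtoℚ-homo-* : ∀ x y → ℤtoℚ (x ℤ.* y) ≡ ℤtoℚ x * ℤtoℚ y
ℤtoℚ-homo-* x y = toℚᵘ-injective (begin
  toℚᵘ (ℤtoℚ (x ℤ.* y))             ≈⟨ toℚᵘ-ℤtoℚ (x ℤ.* y) ⟩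
  ℚᵘ.mkℚᵘ x 0 ℚᵘ.* ℚᵘ.mkℚᵘ y 0      ≈⟨ ℚᵘ.*-cong (toℚᵘ-ℤtoℚ x) (toℚᵘ-ℤtoℚ y) ⟨
  toℚᵘ (ℤtoℚ x) ℚᵘ.* toℚᵘ (ℤtoℚ y)  ≈⟨ toℚᵘ-homo-* (ℤtoℚ x) (ℤtoℚ y) ⟨
  toℚᵘ (ℤtoℚ x * ℤtoℚ y)            ∎)
  where open ℚᵘ.≃-Reasoning

ℤtoℚ-homo‿- : ∀ x → ℤtoℚ (ℤ.- x) ≡ - ℤtoℚ x
ℤtoℚ-homo‿- x = toℚᵘ-injective (begin
  toℚᵘ (ℤtoℚ (ℤ.- x))  ≈⟨ toℚᵘ-ℤtoℚ (ℤ.- x) ⟩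
  ℚᵘ.- ℚᵘ.mkℚᵘ x 0     ≈⟨ ℚᵘ.-‿cong (toℚᵘ-ℤtoℚ x) ⟨
  ℚᵘ.- toℚᵘ (ℤtoℚ x)   ≈⟨ toℚᵘ-homo‿- (ℤtoℚ x) ⟨
  toℚᵘ (- ℤtoℚ x)      ∎)
  where open ℚᵘ.≃-Reasoning

ℤtoℚ-injective : ∀ {x y} → ℤtoℚ x ≡ ℤtoℚ y → x ≡ y
ℤtoℚ-injective {x} {y} eq with ℚᵘ.≃-trans (ℚᵘ.≃-sym (toℚᵘ-ℤtoℚ x))
                                  (ℚᵘ.≃-trans (ℚᵘ.≃-reflexive (cong toℚᵘ eq)) (toℚᵘ-ℤtoℚ y))
... | ℚᵘ.*≡* x*1≡y*1 = ℤ.*-cancelʳ-≡ x y (+ 1) x*1≡y*1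

↧ₙ*q≡↥q : ∀ q → ℕtoℚ (ℚ.↧ₙ q) * q ≡ ℤtoℚ (ℚ.↥ q)
↧ₙ*q≡↥q q@(mkℚ num d-1 _) = toℚᵘ-injective (begin
  toℚᵘ (ℕtoℚ d * q)                     ≈⟨ toℚᵘ-homo-* (ℕtoℚ d) q ⟩
  toℚᵘ (ℕtoℚ d) ℚᵘ.* ℚᵘ.mkℚᵘ num d-1    ≈⟨ ℚᵘ.*-congʳ (toℚᵘ-ℤtoℚ (+ d)) ⟩
  ℚᵘ.mkℚᵘ (+ d) 0 ℚᵘ.* ℚᵘ.mkℚᵘ num d-1  ≈⟨ ℚᵘ.*≡* cross-multiplied ⟩
  ℚᵘ.mkℚᵘ num 0                         ≈⟨ toℚᵘ-ℤtoℚ num ⟨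
  toℚᵘ (ℤtoℚ num)                       ∎)
  where
  open ℚᵘ.≃-Reasoning
  d : ℕ
  d = ℚ.↧ₙ q
  cross-multiplied : (+ d ℤ.* num) ℤ.* + 1 ≡ num ℤ.* + (1 ℕ.* d)
  cross-multiplied = trans (ℤ.*-identityʳ _)
    (trans (ℤ.*-comm (+ d) num) (cong (λ n → num ℤ.* + n) (sym (ℕ.*-identityˡ d))))

isInt-+ : ∀ {p q} → IsInt p → IsInt q → IsInt (p + q)
isInt-+ (x , refl) (y , refl) = x ℤ.+ y , sym (ℤtoℚ-homo-+ x y)

isInt-* : ∀ {p q} → IsInt p → IsInt q → IsInt (p * q)
isInt-* (x , refl) (y , refl) = x ℤ.* y , sym (ℤtoℚ-homo-* x y)

isInt-neg : ∀ {p} → IsInt p → IsInt (- p)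
isInt-neg (x , refl) = ℤ.- x , sym (ℤtoℚ-homo‿- x)

isInt-- : ∀ {p q} → IsInt p → IsInt q → IsInt (p - q)
isInt-- p∈ℤ q∈ℤ = isInt-+ p∈ℤ (isInt-neg q∈ℤ)

ℕtoℚ-homo-* : ∀ m n → ℕtoℚ (m ℕ.* n) ≡ ℕtoℚ m * ℕtoℚ n
ℕtoℚ-homo-* m n = trans (cong ℤtoℚ (ℤ.pos-* m n)) (ℤtoℚ-homo-* (+ m) (+ n))

record HasDenominator (N : ℕ) (q : ℚ) : Set where
  constructor hasDenominator
  field
    N*q∈ℤ : IsInt (ℕtoℚ N * q)

hasDenominator-↧ₙ : ∀ q → HasDenominator (ℚ.↧ₙ q) q
hasDenominator-↧ₙ q = hasDenominator (ℚ.↥ q , ↧ₙ*q≡↥q q)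

hasDenominator-*ˡ : ∀ M {N q} → HasDenominator N q → HasDenominator (M ℕ.* N) q
hasDenominator-*ˡ M {N} {q} (hasDenominator Nq∈ℤ) = hasDenominator (subst IsInt (sym (begin
  ℕtoℚ (M ℕ.* N) * q     ≡⟨ cong (_* q) (ℕtoℚ-homo-* M N) ⟩
  (ℕtoℚ M * ℕtoℚ N) * q  ≡⟨ *-assoc (ℕtoℚ M) (ℕtoℚ N) q ⟩
  ℕtoℚ M * (ℕtoℚ N * q)  ∎)) (isInt-* (+ M , refl) Nq∈ℤ))
  where open ≡-Reasoning

hasDenominator-*ʳ : ∀ M {N q} → HasDenominator N q → HasDenominator (N ℕ.* M) q
hasDenominator-*ʳ M {N} {q} Nq∈ℤ = subst (λ K → HasDenominator K q) (ℕ.*-comm M N) (hasDenominator-*ˡ M Nq∈ℤ)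

hasDenominator-0ℚ : ∀ {N} → HasDenominator N 0ℚ
hasDenominator-0ℚ {N} = hasDenominator (+ 0 , *-zeroʳ (ℕtoℚ N))

hasDenominator-+ : ∀ {N p q} → HasDenominator N p → HasDenominator N q → HasDenominator N (p + q)
hasDenominator-+ {N} {p} {q} (hasDenominator Np∈ℤ) (hasDenominator Nq∈ℤ) =
  hasDenominator (subst IsInt (sym (*-distribˡ-+ (ℕtoℚ N) p q)) (isInt-+ Np∈ℤ Nq∈ℤ))

hasDenominator-ℤtoℚ* : ∀ c {N q} → HasDenominator N q → HasDenominator N (ℤtoℚ c * q)
hasDenominator-ℤtoℚ* c {N} {q} (hasDenominator Nq∈ℤ) =
  hasDenominator (subst IsInt (x∙yz≈y∙xz (ℤtoℚ c) (ℕtoℚ N) q) (isInt-* (c , refl) Nq∈ℤ))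

↧ₙ^n*q^n≡↥^n : ∀ q n → ℕtoℚ (ℚ.↧ₙ q ℕ.^ n) * q ^ n ≡ ℤtoℚ (ℚ.↥ q ℤ.^ n)
↧ₙ^n*q^n≡↥^n q zero = refl
↧ₙ^n*q^n≡↥^n q (suc n) = begin
  ℕtoℚ (d ℕ.* d ℕ.^ n) * (q * q ^ n)       ≡⟨ cong (_* (q * q ^ n)) (ℕtoℚ-homo-* d (d ℕ.^ n)) ⟩
  (ℕtoℚ d * ℕtoℚ (d ℕ.^ n)) * (q * q ^ n)  ≡⟨ interchange (ℕtoℚ d) (ℕtoℚ (d ℕ.^ n)) q (q ^ n) ⟩
  (ℕtoℚ d * q) * (ℕtoℚ (d ℕ.^ n) * q ^ n)  ≡⟨ cong₂ _*_ (↧ₙ*q≡↥q q) (↧ₙ^n*q^n≡↥^n q n) ⟩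
  ℤtoℚ (ℚ.↥ q) * ℤtoℚ (ℚ.↥ q ℤ.^ n)        ≡⟨ ℤtoℚ-homo-* (ℚ.↥ q) (ℚ.↥ q ℤ.^ n) ⟨
  ℤtoℚ (ℚ.↥ q ℤ.^ suc n)                   ∎
  where
  open ≡-Reasoning
  d : ℕ
  d = ℚ.↧ₙ q

coprime-*ˡ : ∀ {m n o} → Coprime m o → Coprime n o → Coprime (m ℕ.* n) o
coprime-*ˡ {m} {n} {o} m⊥o n⊥o {k} (k∣mn , k∣o) = n⊥o (coprime-divisor k⊥m k∣mn , k∣o)
  where
  k⊥m : Coprime k m
  k⊥m (j∣k , j∣m) = m⊥o (j∣m , ∣-trans j∣k k∣o)

coprime-^ˡ : ∀ {m o} n → Coprime m o → Coprime (m ℕ.^ n) o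
coprime-^ˡ {o = o} zero    _   = Coprime.1-coprimeTo o
coprime-^ˡ         (suc n) m⊥o = coprime-*ˡ m⊥o (coprime-^ˡ n m⊥o)

coprime-^ : ∀ {m o} n → Coprime m o → Coprime (m ℕ.^ n) (o ℕ.^ n)
coprime-^ n m⊥o = Coprime.sym (coprime-^ˡ n (Coprime.sym (coprime-^ˡ n m⊥o)))

abs-^ : ∀ i n → ℤ.∣ i ℤ.^ n ∣ ≡ ℤ.∣ i ∣ ℕ.^ n
abs-^ i zero    = refl
abs-^ i (suc n) = trans (ℤ.abs-* i (i ℤ.^ n)) (cong (ℤ.∣ i ∣ ℕ.*_) (abs-^ i n))

n<m^n : ∀ {m} → 1 < m → ∀ n → n < m ℕ.^ n
n<m^n 1<m zero    = s≤s z≤n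
n<m^n {m} 1<m (suc n) = ℕ.≤-<-trans (n<m^n 1<m n) (ℕ.^-monoʳ-< m 1<m (ℕ.n<1+n n))

-- If q = num/d in lowest terms with d ≥ 2, then N·q^N ∈ ℤ gives d^N ∣ N·num^N, hence d^N ∣ N,
-- which contradicts N < d^N.
bounded-denominators-of-powers⇒isInt : ∀ N .{{_ : NonZero N}} q → (∀ n → HasDenominator N (q ^ n)) → IsInt q
bounded-denominators-of-powers⇒isInt N q@(mkℚ num zero _) _ = num , sym (↥p/↧p≡p q)
bounded-denominators-of-powers⇒isInt N q@(mkℚ num (suc _) num⊥d) Nq^n∈ℤ =
  ⊥-elim (ℕ.<⇒≱ (n<m^n (s≤s (s≤s z≤n)) N) (∣⇒≤ d^N∣N))
  where
  d : ℕ
  d = ℚ.↧ₙ q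
  z : ℤ
  z = proj₁ (HasDenominator.N*q∈ℤ (Nq^n∈ℤ N))
  N*num^N≡d^N*z : + N ℤ.* num ℤ.^ N ≡ + (d ℕ.^ N) ℤ.* z
  N*num^N≡d^N*z = ℤtoℚ-injective (begin
    ℤtoℚ (+ N ℤ.* num ℤ.^ N)           ≡⟨ ℤtoℚ-homo-* (+ N) (num ℤ.^ N) ⟩
    ℕtoℚ N * ℤtoℚ (num ℤ.^ N)          ≡⟨ cong (ℕtoℚ N *_) (↧ₙ^n*q^n≡↥^n q N) ⟨
    ℕtoℚ N * (ℕtoℚ (d ℕ.^ N) * q ^ N)  ≡⟨ x∙yz≈y∙xz (ℕtoℚ N) (ℕtoℚ (d ℕ.^ N)) (q ^ N) ⟩
    ℕtoℚ (d ℕ.^ N) * (ℕtoℚ N * q ^ N)  ≡⟨ cong (ℕtoℚ (d ℕ.^ N) *_) (proj₂ (HasDenominator.N*q∈ℤ (Nq^n∈ℤ N))) ⟩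
    ℕtoℚ (d ℕ.^ N) * ℤtoℚ z            ≡⟨ ℤtoℚ-homo-* (+ (d ℕ.^ N)) z ⟨
    ℤtoℚ (+ (d ℕ.^ N) ℤ.* z)           ∎)
    where open ≡-Reasoning
  d^N∣num^N*N : d ℕ.^ N ∣ ℤ.∣ num ∣ ℕ.^ N ℕ.* N
  d^N∣num^N*N = divides ℤ.∣ z ∣ (begin
    ℤ.∣ num ∣ ℕ.^ N ℕ.* N    ≡⟨ ℕ.*-comm (ℤ.∣ num ∣ ℕ.^ N) N ⟩
    N ℕ.* ℤ.∣ num ∣ ℕ.^ N    ≡⟨ cong (N ℕ.*_) (abs-^ num N) ⟨
    N ℕ.* ℤ.∣ num ℤ.^ N ∣    ≡⟨ ℤ.abs-* (+ N) (num ℤ.^ N) ⟨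
    ℤ.∣ + N ℤ.* num ℤ.^ N ∣  ≡⟨ cong ℤ.∣_∣ N*num^N≡d^N*z ⟩
    ℤ.∣ + (d ℕ.^ N) ℤ.* z ∣  ≡⟨ ℤ.abs-* (+ (d ℕ.^ N)) z ⟩
    d ℕ.^ N ℕ.* ℤ.∣ z ∣      ≡⟨ ℕ.*-comm (d ℕ.^ N) ℤ.∣ z ∣ ⟩
    ℤ.∣ z ∣ ℕ.* d ℕ.^ N      ∎)
    where open ≡-Reasoning
  d^N∣N : d ℕ.^ N ∣ N
  d^N∣N = coprime-divisor (coprime-^ N (Coprime.sym (Coprime.recompute num⊥d))) d^N∣num^N*N

-- Counting with finite types

private
  orElse : ∀ {B : Set} (u w : ⊤ ⊎ B) → .(u ≡ inj₁ tt → w ≡ inj₁ tt → ⊥) → B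
  orElse (inj₂ y)  _         _    = y
  orElse (inj₁ _)  (inj₂ y)  _    = y
  orElse (inj₁ tt) (inj₁ tt) both = ⊥-elim-irr (both refl refl)

  orElse-first : ∀ {B : Set} {u w : ⊤ ⊎ B} {y} .{both} → u ≡ inj₂ y → orElse u w both ≡ y
  orElse-first refl = refl

  orElse-second : ∀ {B : Set} {u w : ⊤ ⊎ B} {y} .{both} → u ≡ inj₁ tt → w ≡ inj₂ y → orElse u w both ≡ y
  orElse-second refl refl = refl

-- x goes to f x or, when that is the extra point, to the image of the extra point.
skipPoint : ∀ {A B : Set} → (⊤ ⊎ A) ↔ (⊤ ⊎ B) → A → B
skipPoint f x = orElse (to (inj₂ x)) (to (inj₁ tt)) λ x↦pt pt↦pt →
  case trans (sym (to-from f x↦pt)) (to-from f pt↦pt) of λ ()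
  where open Inverse f

skipPoint-inverse : ∀ {A B : Set} (f : (⊤ ⊎ A) ↔ (⊤ ⊎ B)) y → skipPoint f (skipPoint (↔-sym f) y) ≡ y
skipPoint-inverse f y = go (from (inj₂ y)) refl (from (inj₁ tt)) refl
  where
  open Inverse f
  to-from⁻¹ : ∀ {u w} → from u ≡ w → to w ≡ u
  to-from⁻¹ = to-from (↔-sym f)
  go : ∀ u → from (inj₂ y) ≡ u → ∀ w → from (inj₁ tt) ≡ w → skipPoint f (skipPoint (↔-sym f) y) ≡ y
  go (inj₂ x)  y↤x  _         _     =
    trans (cong (skipPoint f) (orElse-first y↤x)) (orElse-first (to-from⁻¹ y↤x))
  go (inj₁ tt) y↤pt (inj₂ x)  pt↤x  =
    trans (cong (skipPoint f) (orElse-second y↤pt pt↤x)) (orElse-second (to-from⁻¹ pt↤x) (to-from⁻¹ y↤pt))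
  go (inj₁ tt) y↤pt (inj₁ tt) pt↤pt = case trans (sym (to-from⁻¹ y↤pt)) (to-from⁻¹ pt↤pt) of λ ()

⊎-cancelˡ-⊤ : ∀ {A B : Set} → (⊤ ⊎ A) ↔ (⊤ ⊎ B) → A ↔ B
⊎-cancelˡ-⊤ f = mk↔ₛ′ (skipPoint f) (skipPoint (↔-sym f)) (skipPoint-inverse f) (skipPoint-inverse (↔-sym f))

Fin0-⊎ : ∀ {A : Set} → (Fin 0 ⊎ A) ↔ A
Fin0-⊎ = mk↔ₛ′ (λ { (inj₂ x) → x ; (inj₁ ()) }) inj₂ (λ _ → refl) (λ { (inj₂ _) → refl ; (inj₁ ()) })

Fin-⊎-cancel : ∀ {A : Set} j n → (Fin j ⊎ A) ↔ Fin n → A ↔ Fin (n ∸ j)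
Fin-⊎-cancel zero    n       f = ↔-trans (↔-sym Fin0-⊎) f
Fin-⊎-cancel (suc j) zero    f = case Inverse.to f (inj₁ Fin.zero) of λ ()
Fin-⊎-cancel {A} (suc j) (suc n) f = Fin-⊎-cancel j n (⊎-cancelˡ-⊤ (begin
  (⊤ ⊎ (Fin j ⊎ A))       ↔⟨ Fin.1↔⊤ ⊎-↔ ↔-refl ⟨
  (Fin 1 ⊎ (Fin j ⊎ A))   ↔⟨ ⊎-assoc _ (Fin 1) (Fin j) A ⟨
  ((Fin 1 ⊎ Fin j) ⊎ A)   ↔⟨ Fin.+↔⊎ ⊎-↔ ↔-refl ⟨
  (Fin (suc j) ⊎ A)       ↔⟨ f ⟩
  Fin (suc n)             ↔⟨ Fin.+↔⊎ ⟩
  (Fin 1 ⊎ Fin n)         ↔⟨ Fin.1↔⊤ ⊎-↔ ↔-refl ⟩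
  (⊤ ⊎ Fin n)             ∎))
  where open Related.EquationalReasoning

Σ-Fin-suc : ∀ {n} (Q : Fin (suc n) → Set) → Σ (Fin (suc n)) Q ↔ (Q Fin.zero ⊎ Σ (Fin n) (Q ∘ Fin.suc))
Σ-Fin-suc Q = mk↔ₛ′
  (λ { (Fin.zero , x) → inj₁ x ; (Fin.suc i , x) → inj₂ (i , x) })
  (λ { (inj₁ x) → Fin.zero , x ; (inj₂ (i , x)) → Fin.suc i , x })
  (λ { (inj₁ x) → refl ; (inj₂ (i , x)) → refl })
  (λ { (Fin.zero , x) → refl ; (Fin.suc i , x) → refl })

Σ-Fin↔sum : ∀ n {Q : Fin n → Set} (f : Fin n → ℕ) → (∀ i → Q i ↔ Fin (f i)) → Σ (Fin n) Q ↔ Fin (sum f)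
Σ-Fin↔sum zero    f _   = mk↔ₛ′ (λ { (() , _) }) (λ ()) (λ ()) (λ { (() , _) })
Σ-Fin↔sum (suc n) {Q} f Q↔f =
  ↔-trans (Σ-Fin-suc Q)
    (↔-trans (Q↔f Fin.zero ⊎-↔ Σ-Fin↔sum n (f ∘ Fin.suc) (Q↔f ∘ Fin.suc)) (↔-sym Fin.+↔⊎))

Σℕ↔ΣFin : ∀ k {P : ℕ → Set} → (∀ {d} → P d → 1 ≤ d × d ≤ k) → Σ ℕ P ↔ Σ (Fin k) (P ∘ suc ∘ toℕ)
Σℕ↔ΣFin k {P} bounds = mk↔ₛ′ to from to∘from from∘to
  where
  to : Σ ℕ P → Σ (Fin k) (P ∘ suc ∘ toℕ)
  to (zero  , x) = case proj₁ (bounds x) of λ ()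
  to (suc d , x) = fromℕ< (proj₂ (bounds x)) , subst (P ∘ suc) (sym (Fin.toℕ-fromℕ< (proj₂ (bounds x)))) x

  from : Σ (Fin k) (P ∘ suc ∘ toℕ) → Σ ℕ P
  from (i , x) = suc (toℕ i) , x

  from∘to : ∀ s → from (to s) ≡ s
  from∘to (zero  , x) = case proj₁ (bounds x) of λ ()
  from∘to (suc d , x) = go (Fin.toℕ-fromℕ< (proj₂ (bounds x)))
    where
    go : ∀ {m} (m≡d : m ≡ d) → (suc m , subst (P ∘ suc) (sym m≡d) x) ≡ (suc d , x)
    go refl = refl

  to∘from : ∀ s → to (from s) ≡ s
  to∘from (i , x) = go (Fin.toℕ-fromℕ< (proj₂ (bounds x)))
    where
    go : ∀ {j} (j≡i : toℕ j ≡ toℕ i) → (j , subst (P ∘ suc) (sym j≡i) x) ≡ (i , x)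
    go j≡i with Fin.toℕ-injective j≡i
    ... | refl rewrite ℕ.≡-irrelevant j≡i refl = refl

-- θEq v w k unfolds to EqualCount 2 (Sol v k) (Sol w k), and θ'Eq v w k to the same with SolPrim;
-- the factor 2 is the halving in the definition of θ.
EqualCount : ℕ → Set → Set → Set
EqualCount c A B = ∃ λ m → (A ↔ Fin (c ℕ.* m)) × (B ↔ Fin (c ℕ.* m))

module _ {c : ℕ} where

  EqualCount-↔ : ∀ {A A′ B B′} → A ↔ A′ → B ↔ B′ → EqualCount c A B → EqualCount c A′ B′
  EqualCount-↔ A↔A′ B↔B′ (m , A↔cm , B↔cm) = m , ↔-trans (↔-sym A↔A′) A↔cm , ↔-trans (↔-sym B↔B′) B↔cm

  EqualCount-empty : ∀ {A B} → ¬ A → ¬ B → EqualCount c A B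
  EqualCount-empty ¬a ¬b = 0 , ↔Fin0 ¬a , ↔Fin0 ¬b
    where
    ↔Fin0 : ∀ {A} → ¬ A → A ↔ Fin (c ℕ.* 0)
    ↔Fin0 ¬a rewrite ℕ.*-zeroʳ c = mk↔ₛ′ (⊥-elim ∘ ¬a) (λ ()) (λ ()) (⊥-elim ∘ ¬a)

  EqualCount-Σ : ∀ {n} {Q Q′ : Fin n → Set} → (∀ i → EqualCount c (Q i) (Q′ i)) →
                 EqualCount c (Σ (Fin n) Q) (Σ (Fin n) Q′)
  EqualCount-Σ {n} {Q} {Q′} Q≈Q′ = sum m , count (proj₁ ∘ proj₂ ∘ Q≈Q′) , count (proj₂ ∘ proj₂ ∘ Q≈Q′)
    where
    m : Fin n → ℕ
    m = proj₁ ∘ Q≈Q′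
    count : ∀ {R : Fin n → Set} → (∀ i → R i ↔ Fin (c ℕ.* m i)) → Σ (Fin n) R ↔ Fin (c ℕ.* sum m)
    count R↔ = subst (λ l → _ ↔ Fin l) (sym (*-distribˡ-sum c m)) (Σ-Fin↔sum n (λ i → c ℕ.* m i) R↔)

  EqualCount-cancel : ∀ {A A′ R R′} → EqualCount c (A ⊎ R) (A′ ⊎ R′) → EqualCount c R R′ → EqualCount c A A′
  EqualCount-cancel (m , AR↔ , AR′↔) (M , R↔ , R′↔) = m ∸ M , cancel AR↔ R↔ , cancel AR′↔ R′↔
    where
    cancel : ∀ {A R} → (A ⊎ R) ↔ Fin (c ℕ.* m) → R ↔ Fin (c ℕ.* M) → A ↔ Fin (c ℕ.* (m ∸ M))
    cancel {A} {R} AR↔ R↔ = subst (λ l → A ↔ Fin l) (sym (ℕ.*-distribˡ-∸ c m M))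
      (Fin-⊎-cancel (c ℕ.* M) (c ℕ.* m) (↔-trans (↔-sym R↔ ⊎-↔ ↔-refl) (↔-trans (⊎-comm R A) AR↔)))

SquareQuotient : (ℕ → Set) → ℕ → ℕ → Set
SquareQuotient P k d = ∃ λ q → q ℕ.* (d ℕ.* d) ≡ k × P q

-- The type-level form of Σ_{d²q=k} P(q).
SquareDivisorSum : (ℕ → Set) → ℕ → Set
SquareDivisorSum P k = ∃ (SquareQuotient P k)

module _ (q d : ℕ) {k} .{{_ : NonZero k}} (q*d²≡k : q ℕ.* (d ℕ.* d) ≡ k) where
  private
    instance
      q*d²≢0 : NonZero (q ℕ.* (d ℕ.* d))
      q*d²≢0 = ℕ.≢-nonZero λ q*d²≡0 → ℕ.≢-nonZero⁻¹ k (trans (sym q*d²≡k) q*d²≡0)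

      q≢0 : NonZero q
      q≢0 = ℕ.m*n≢0⇒m≢0 q

      d²≢0 : NonZero (d ℕ.* d)
      d²≢0 = ℕ.m*n≢0⇒n≢0 q

      d≢0 : NonZero d
      d≢0 = ℕ.m*n≢0⇒m≢0 d

  q*d²≡k⇒1≤q : 1 ≤ q
  q*d²≡k⇒1≤q = ℕ.>-nonZero⁻¹ q

  q*d²≡k⇒1≤d : 1 ≤ d
  q*d²≡k⇒1≤d = ℕ.>-nonZero⁻¹ d

  q*d²≡k⇒q≤k : q ≤ k
  q*d²≡k⇒q≤k = subst (q ≤_) q*d²≡k (ℕ.m≤m*n q (d ℕ.* d))

  q*d²≡k⇒d≤k : d ≤ k
  q*d²≡k⇒d≤k = subst (d ≤_) q*d²≡k (ℕ.≤-trans (ℕ.m≤m*n d d) (ℕ.m≤n*m (d ℕ.* d) q))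

  q*d²≡k⇒q<k : 2 ≤ d → q < k
  q*d²≡k⇒q<k 2≤d = subst (q <_) q*d²≡k (ℕ.m<m*n q (d ℕ.* d) (ℕ.<-≤-trans 2≤d (ℕ.m≤m*n d d)))

SquareQuotient↔ : ∀ {P q d k} .{{_ : NonZero d}} → q ℕ.* (d ℕ.* d) ≡ k → SquareQuotient P k d ↔ P q
SquareQuotient↔ {P} {q} {d} {k} q*d²≡k = mk↔ₛ′ to (λ x → q , q*d²≡k , x) to∘from from∘to
  where
  unique : ∀ {q′} → q′ ℕ.* (d ℕ.* d) ≡ k → q′ ≡ q
  unique q′*d²≡k = ℕ.*-cancelʳ-≡ _ q (d ℕ.* d) {{ℕ.m*n≢0 d d}} (trans q′*d²≡k (sym q*d²≡k))
  to : SquareQuotient P k d → P q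
  to (_ , q′*d²≡k , x) = subst P (unique q′*d²≡k) x
  to∘from : ∀ x → to (q , q*d²≡k , x) ≡ x
  to∘from x rewrite ℕ.≡-irrelevant (unique q*d²≡k) refl = refl
  from∘to : ∀ s → (q , q*d²≡k , to s) ≡ s
  from∘to (q′ , q′*d²≡k , x) = go (unique q′*d²≡k) q′*d²≡k
    where
    go : (q′≡q : q′ ≡ q) (e : q′ ℕ.* (d ℕ.* d) ≡ k) → (q , q*d²≡k , subst P q′≡q x) ≡ (q′ , e , x)
    go refl e rewrite ℕ.≡-irrelevant q*d²≡k e = refl

module _ {P : ℕ → Set} where

  SquareDivisorSum↔ΣFin : ∀ k .{{_ : NonZero k}} → SquareDivisorSum P k ↔ Σ (Fin k) (SquareQuotient P k ∘ suc ∘ toℕ)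
  SquareDivisorSum↔ΣFin k =
    Σℕ↔ΣFin k λ {d} (q , q*d²≡k , _) → q*d²≡k⇒1≤d q d q*d²≡k , q*d²≡k⇒d≤k q d q*d²≡k

  SquareDivisorSum-split : ∀ k → SquareDivisorSum P (suc k) ↔
    (P (suc k) ⊎ Σ (Fin k) (λ i → SquareQuotient P (suc k) (2 ℕ.+ toℕ i)))
  SquareDivisorSum-split k = ↔-trans (SquareDivisorSum↔ΣFin (suc k))
    (↔-trans (Σ-Fin-suc (SquareQuotient P (suc k) ∘ suc ∘ toℕ))
             (SquareQuotient↔ {d = 1} (ℕ.*-identityʳ (suc k)) ⊎-↔ ↔-refl))

EqualCountUpTo : ℕ → ℕ → (ℕ → Set) → (ℕ → Set) → Set
EqualCountUpTo c bd S S′ = ∀ k → 1 ≤ k → k ≤ bd → EqualCount c (S k) (S′ k)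

module _ {c : ℕ} {P P′ : ℕ → Set} where

  EqualCount-SquareQuotient : ∀ {k d} .{{_ : NonZero d}} →
    (∀ q → q ℕ.* (d ℕ.* d) ≡ k → EqualCount c (P q) (P′ q)) →
    EqualCount c (SquareQuotient P k d) (SquareQuotient P′ k d)
  EqualCount-SquareQuotient {k} {d} P≈P′ with (d ℕ.* d) ∣? k
  ... | yes (divides q k≡q*d²) =
    EqualCount-↔ {c} (↔-sym (SquareQuotient↔ (sym k≡q*d²))) (↔-sym (SquareQuotient↔ (sym k≡q*d²)))
                     (P≈P′ q (sym k≡q*d²))
  ... | no d²∤k = EqualCount-empty {c} (λ (q , q*d²≡k , _) → d²∤k (divides q (sym q*d²≡k)))
                                       (λ (q , q*d²≡k , _) → d²∤k (divides q (sym q*d²≡k)))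

  EqualCount-SquareDivisorSum⁺ : ∀ bd → EqualCountUpTo c bd P P′ →
                                 EqualCountUpTo c bd (SquareDivisorSum P) (SquareDivisorSum P′)
  EqualCount-SquareDivisorSum⁺ bd P≈P′ k@(suc _) _ k≤bd =
    EqualCount-↔ {c} (↔-sym (SquareDivisorSum↔ΣFin k)) (↔-sym (SquareDivisorSum↔ΣFin k))
      (EqualCount-Σ {c} λ i → EqualCount-SquareQuotient {k} {suc (toℕ i)} λ q q*d²≡k →
        P≈P′ q (q*d²≡k⇒1≤q q (suc (toℕ i)) q*d²≡k)
               (ℕ.≤-trans (q*d²≡k⇒q≤k q (suc (toℕ i)) q*d²≡k) k≤bd))

  EqualCount-SquareDivisorSum⁻ : ∀ bd → EqualCountUpTo c bd (SquareDivisorSum P) (SquareDivisorSum P′) →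
                                 EqualCountUpTo c bd P P′
  EqualCount-SquareDivisorSum⁻ bd S≈S′ = <-rec Goal step
    where
    Goal : ℕ → Set
    Goal k = 1 ≤ k → k ≤ bd → EqualCount c (P k) (P′ k)
    step : ∀ k → (∀ {j} → j < k → Goal j) → Goal k
    step k@(suc k-1) smaller _ k≤bd = EqualCount-cancel {c}
      (EqualCount-↔ {c} (SquareDivisorSum-split k-1) (SquareDivisorSum-split k-1) (S≈S′ k (s≤s z≤n) k≤bd))
      (EqualCount-Σ {c} λ i → EqualCount-SquareQuotient {k} {2 ℕ.+ toℕ i} λ q q*d²≡k →
        let q<k = q*d²≡k⇒q<k q (2 ℕ.+ toℕ i) q*d²≡k (s≤s (s≤s z≤n)) in
        smaller q<k (q*d²≡k⇒1≤q q (2 ℕ.+ toℕ i) q*d²≡k) (ℕ.≤-trans (ℕ.<⇒≤ q<k) k≤bd))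

  EqualCount-inversion : ∀ {S S′ : ℕ → Set} →
    (∀ k → 1 ≤ k → S k ↔ SquareDivisorSum P k) → (∀ k → 1 ≤ k → S′ k ↔ SquareDivisorSum P′ k) → ∀ bd →
    (EqualCountUpTo c bd S S′ → EqualCountUpTo c bd P P′) × (EqualCountUpTo c bd P P′ → EqualCountUpTo c bd S S′)
  EqualCount-inversion S↔ S′↔ bd =
    (λ S≈S′ → EqualCount-SquareDivisorSum⁻ bd λ k 1≤k k≤bd →
      EqualCount-↔ {c} (S↔ k 1≤k) (S′↔ k 1≤k) (S≈S′ k 1≤k k≤bd)) ,
    (λ P≈P′ k 1≤k k≤bd → EqualCount-↔ {c} (↔-sym (S↔ k 1≤k)) (↔-sym (S′↔ k 1≤k))
      (EqualCount-SquareDivisorSum⁺ bd P≈P′ k 1≤k k≤bd))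

-- Identities in the quaternion algebra

quat-ext : ∀ {x y} → x₀ x ≡ x₀ y → x₁ x ≡ x₁ y → x₂ x ≡ x₂ y → x₃ x ≡ x₃ y → x ≡ y
quat-ext refl refl refl refl = refl

-- Nr, ⊗, ·, ⊕, scalar and Tr of Defs transcribed to solver polynomials, so that identities
-- for the norm can be handed to the ring solver.
module QuatPolynomial {n} (a b : Polynomial n) where
  Quatₚ : Set
  Quatₚ = Polynomial n × Polynomial n × Polynomial n × Polynomial n

  Nrₚ : Quatₚ → Polynomial n
  Nrₚ (x0 , x1 , x2 , x3) = x0 :* x0 :- a :* x1 :* x1 :- b :* x2 :* x2 :+ a :* b :* x3 :* x3

  _⊗ₚ_ : Quatₚ → Quatₚ → Quatₚ
  (x0 , x1 , x2 , x3) ⊗ₚ (y0 , y1 , y2 , y3) =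
    x0 :* y0 :+ a :* x1 :* y1 :+ b :* x2 :* y2 :- a :* b :* x3 :* y3 ,
    x0 :* y1 :+ x1 :* y0 :- b :* x2 :* y3 :+ b :* x3 :* y2 ,
    x0 :* y2 :+ x2 :* y0 :+ a :* x1 :* y3 :- a :* x3 :* y1 ,
    x0 :* y3 :+ x3 :* y0 :+ x1 :* y2 :- x2 :* y1

  _·ₚ_ : Polynomial n → Quatₚ → Quatₚ
  t ·ₚ (x0 , x1 , x2 , x3) = t :* x0 , t :* x1 , t :* x2 , t :* x3

  _⊕ₚ_ : Quatₚ → Quatₚ → Quatₚ
  (x0 , x1 , x2 , x3) ⊕ₚ (y0 , y1 , y2 , y3) = x0 :+ y0 , x1 :+ y1 , x2 :+ y2 , x3 :+ y3

  scalarₚ : Polynomial n → Quatₚ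
  scalarₚ t = t , con 0ℚ , con 0ℚ , con 0ℚ

  Trₚ : Quatₚ → Polynomial n
  Trₚ (x0 , _ , _ , _) = con (ℕtoℚ 2) :* x0

module _ (a b : ℚ) where
  open Algebra a b

  Nr-⊗ : ∀ x y → Nr (x ⊗ y) ≡ Nr x * Nr y
  Nr-⊗ x y = solve 10 (λ a b x0 x1 x2 x3 y0 y1 y2 y3 →
      let open QuatPolynomial a b; X = x0 , x1 , x2 , x3; Y = y0 , y1 , y2 , y3 in
      Nrₚ (X ⊗ₚ Y) := Nrₚ X :* Nrₚ Y)
    refl a b (x₀ x) (x₁ x) (x₂ x) (x₃ x) (x₀ y) (x₁ y) (x₂ y) (x₃ y)

  Nr-· : ∀ t x → Nr (t · x) ≡ t * t * Nr x
  Nr-· t x = solve 7 (λ a b t x0 x1 x2 x3 → let open QuatPolynomial a b in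
      Nrₚ (t ·ₚ (x0 , x1 , x2 , x3)) := t :* t :* Nrₚ (x0 , x1 , x2 , x3))
    refl a b t (x₀ x) (x₁ x) (x₂ x) (x₃ x)

  Nr-oneQ : Nr oneQ ≡ 1ℚ
  Nr-oneQ = solve 2 (λ a b → let open QuatPolynomial a b in Nrₚ (scalarₚ (con 1ℚ)) := con 1ℚ) refl a b

  Nr-oneQ⊕ : ∀ y → Nr (oneQ ⊕ y) ≡ 1ℚ + Tr y + Nr y
  Nr-oneQ⊕ y = solve 6 (λ a b y0 y1 y2 y3 → let open QuatPolynomial a b; Y = y0 , y1 , y2 , y3 in
      Nrₚ (scalarₚ (con 1ℚ) ⊕ₚ Y) := con 1ℚ :+ Trₚ Y :+ Nrₚ Y)
    refl a b (x₀ y) (x₁ y) (x₂ y) (x₃ y)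

  Nr-ᵀ : ∀ y → Nr ((ℕtoℚ 2 · y) ⊕ ((- 1ℚ) · scalar (Tr y))) ≡ ℕtoℚ 4 * Nr y - Tr y * Tr y
  Nr-ᵀ y = solve 6 (λ a b y0 y1 y2 y3 → let open QuatPolynomial a b; Y = y0 , y1 , y2 , y3 in
      Nrₚ ((con (ℕtoℚ 2) ·ₚ Y) ⊕ₚ (con (- 1ℚ) ·ₚ scalarₚ (Trₚ Y)))
        := con (ℕtoℚ 4) :* Nrₚ Y :- Trₚ Y :* Trₚ Y)
    refl a b (x₀ y) (x₁ y) (x₂ y) (x₃ y)

  comb-map-* : ∀ {n} g (c : Vec ℤ n) v → comb (map (g ℤ.*_) c) v ≡ ℤtoℚ g · comb c v
  comb-map-* g []       []       = quat-ext g*0≡0 g*0≡0 g*0≡0 g*0≡0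
    where
    g*0≡0 : 0ℚ ≡ ℤtoℚ g * 0ℚ
    g*0≡0 = sym (*-zeroʳ (ℤtoℚ g))
  comb-map-* g (c ∷ cs) (x ∷ xs) = begin
    (ℤtoℚ (g ℤ.* c) · x) ⊕ comb (map (g ℤ.*_) cs) xs
      ≡⟨ cong₂ (λ s r → (s · x) ⊕ r) (ℤtoℚ-homo-* g c) (comb-map-* g cs xs) ⟩
    ((ℤtoℚ g * ℤtoℚ c) · x) ⊕ (ℤtoℚ g · r)
      ≡⟨ quat-ext (distrib (x₀ x) (x₀ r)) (distrib (x₁ x) (x₁ r))
                  (distrib (x₂ x) (x₂ r)) (distrib (x₃ x) (x₃ r)) ⟩
    ℤtoℚ g · ((ℤtoℚ c · x) ⊕ r)
      ∎
    where
    open ≡-Reasoning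
    r : Quat
    r = comb cs xs
    distrib : ∀ x r → (ℤtoℚ g * ℤtoℚ c) * x + ℤtoℚ g * r ≡ ℤtoℚ g * (ℤtoℚ c * x + r)
    distrib = solve 4 (λ g c x r → (g :* c) :* x :+ g :* r := g :* (c :* x :+ r)) refl (ℤtoℚ g) (ℤtoℚ c)

  comb-zipWith-+ : ∀ {n} (c d : Vec ℤ n) e → comb c e ⊕ comb d e ≡ comb (zipWith ℤ._+_ c d) e
  comb-zipWith-+ []       []       []       = refl
  comb-zipWith-+ (c ∷ cs) (d ∷ ds) (x ∷ xs) = begin
    ((ℤtoℚ c · x) ⊕ r) ⊕ ((ℤtoℚ d · x) ⊕ s)
      ≡⟨ quat-ext (collect (x₀ x) (x₀ r) (x₀ s)) (collect (x₁ x) (x₁ r) (x₁ s))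
                  (collect (x₂ x) (x₂ r) (x₂ s)) (collect (x₃ x) (x₃ r) (x₃ s)) ⟩
    ((ℤtoℚ c + ℤtoℚ d) · x) ⊕ (r ⊕ s)
      ≡⟨ cong₂ (λ t u → (t · x) ⊕ u) (sym (ℤtoℚ-homo-+ c d)) (comb-zipWith-+ cs ds xs) ⟩
    (ℤtoℚ (c ℤ.+ d) · x) ⊕ comb (zipWith ℤ._+_ cs ds) xs
      ∎
    where
    open ≡-Reasoning
    r s : Quat
    r = comb cs xs
    s = comb ds xs
    collect : ∀ x r s → (ℤtoℚ c * x + r) + (ℤtoℚ d * x + s) ≡ (ℤtoℚ c + ℤtoℚ d) * x + (r + s)
    collect = solve 5 (λ c d x r s → (c :* x :+ r) :+ (d :* x :+ s) := (c :+ d) :* x :+ (r :+ s)) refl (ℤtoℚ c) (ℤtoℚ d)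

-- Norms and traces on an order are integers

AllCoords : (ℚ → Set) → Quat → Set
AllCoords P x = P (x₀ x) × P (x₁ x) × P (x₂ x) × P (x₃ x)

mapCoords : ∀ {P Q : ℚ → Set} {x} → (∀ {q} → P q → Q q) → AllCoords P x → AllCoords Q x
mapCoords f (p₀ , p₁ , p₂ , p₃) = f p₀ , f p₁ , f p₂ , f p₃

denominatorᴴ : Quat → ℕ
denominatorᴴ x = ℚ.↧ₙ (x₀ x) ℕ.* ℚ.↧ₙ (x₁ x) ℕ.* ℚ.↧ₙ (x₂ x) ℕ.* ℚ.↧ₙ (x₃ x)

commonDenominator : ∀ {n} → Vec Quat n → ℕ
commonDenominator []       = 1
commonDenominator (x ∷ xs) = denominatorᴴ x ℕ.* commonDenominator xs

commonDenominator-nonZero : ∀ {n} (e : Vec Quat n) → NonZero (commonDenominator e)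
commonDenominator-nonZero []       = _
commonDenominator-nonZero (x ∷ xs) = ℕ.m*n≢0 (denominatorᴴ x) (commonDenominator xs) {{_}} {{commonDenominator-nonZero xs}}

hasCommonDenominator : ∀ {n} (e : Vec Quat n) → All (AllCoords (HasDenominator (commonDenominator e))) e
hasCommonDenominator []       = []
hasCommonDenominator (x ∷ xs) =
  mapCoords {HasDenominator (denominatorᴴ x)} (hasDenominator-*ʳ (commonDenominator xs)) own ∷
  All.map (mapCoords {HasDenominator (commonDenominator xs)} (hasDenominator-*ˡ (denominatorᴴ x)))
          (hasCommonDenominator xs)
  where
  d₀ d₁ d₂ d₃ : ℕ
  d₀ = ℚ.↧ₙ (x₀ x)
  d₁ = ℚ.↧ₙ (x₁ x)
  d₂ = ℚ.↧ₙ (x₂ x)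
  d₃ = ℚ.↧ₙ (x₃ x)
  own : AllCoords (HasDenominator (denominatorᴴ x)) x
  own = hasDenominator-*ʳ d₃ (hasDenominator-*ʳ d₂ (hasDenominator-*ʳ d₁ (hasDenominator-↧ₙ (x₀ x)))) ,
        hasDenominator-*ʳ d₃ (hasDenominator-*ʳ d₂ (hasDenominator-*ˡ d₀ (hasDenominator-↧ₙ (x₁ x)))) ,
        hasDenominator-*ʳ d₃ (hasDenominator-*ˡ (d₀ ℕ.* d₁) (hasDenominator-↧ₙ (x₂ x))) ,
        hasDenominator-*ˡ (d₀ ℕ.* d₁ ℕ.* d₂) (hasDenominator-↧ₙ (x₃ x))

module _ (a b : ℚ) where
  open Algebra a b

  comb-hasDenominator : ∀ {n N} {e : Vec Quat n} → All (AllCoords (HasDenominator N)) e →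
                        ∀ c → AllCoords (HasDenominator N) (comb c e)
  comb-hasDenominator [] [] = hasDenominator-0ℚ , hasDenominator-0ℚ , hasDenominator-0ℚ , hasDenominator-0ℚ
  comb-hasDenominator ((h₀ , h₁ , h₂ , h₃) ∷ hs) (c ∷ cs) with comb-hasDenominator hs cs
  ... | r₀ , r₁ , r₂ , r₃ = add-cx h₀ r₀ , add-cx h₁ r₁ , add-cx h₂ r₂ , add-cx h₃ r₃
    where
    add-cx : ∀ {N x r} → HasDenominator N x → HasDenominator N r → HasDenominator N (ℤtoℚ c * x + r)
    add-cx hx hr = hasDenominator-+ (hasDenominator-ℤtoℚ* c hx) hr

  _^ᴴ_ : Quat → ℕ → Quat
  y ^ᴴ zero  = oneQ
  y ^ᴴ suc n = y ⊗ (y ^ᴴ n)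

  Nr-^ᴴ : ∀ y n → Nr (y ^ᴴ n) ≡ Nr y ^ n
  Nr-^ᴴ y zero    = Nr-oneQ a b
  Nr-^ᴴ y (suc n) = trans (Nr-⊗ a b y (y ^ᴴ n)) (cong (Nr y *_) (Nr-^ᴴ y n))

  module _ (a∈ℤ : IsInt a) (b∈ℤ : IsInt b) where

    integral-coords⇒Nr-isInt : ∀ {x} → AllCoords IsInt x → IsInt (Nr x)
    integral-coords⇒Nr-isInt (x0 , x1 , x2 , x3) =
      isInt-+ (isInt-- (isInt-- (isInt-* x0 x0) (isInt-* (isInt-* a∈ℤ x1) x1)) (isInt-* (isInt-* b∈ℤ x2) x2))
              (isInt-* (isInt-* (isInt-* a∈ℤ b∈ℤ) x3) x3)

    Nr-hasDenominator : ∀ {N x} → AllCoords (HasDenominator N) x → HasDenominator (N ℕ.* N) (Nr x)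
    Nr-hasDenominator {N} {x} x-hasDenominator = hasDenominator
      (subst IsInt (trans (Nr-· a b (ℕtoℚ N) x) (cong (_* Nr x) (sym (ℕtoℚ-homo-* N N))))
        (integral-coords⇒Nr-isInt {ℕtoℚ N · x} (mapCoords {P = HasDenominator N} HasDenominator.N*q∈ℤ x-hasDenominator)))

    module Order {O : Quat → Set} (isOrder : IsOrder O) where

      1∈O : O oneQ
      1∈O = proj₁ isOrder

      ⊗-closed : ∀ {x y} → O x → O y → O (x ⊗ y)
      ⊗-closed = proj₁ (proj₂ isOrder) _ _

      basis : Vec Quat 4
      basis = proj₁ (proj₂ (proj₂ isOrder))

      basis-spans : ∀ x → O x ⇔ ∃ λ c → comb c basis ≡ x
      basis-spans = proj₁ (proj₂ (proj₂ (proj₂ isOrder)))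

      ⊕-closed : ∀ {x y} → O x → O y → O (x ⊕ y)
      ⊕-closed x∈O y∈O with Equivalence.to (basis-spans _) x∈O | Equivalence.to (basis-spans _) y∈O
      ... | c , refl | d , refl = Equivalence.from (basis-spans _) (zipWith ℤ._+_ c d , sym (comb-zipWith-+ a b c d basis))

      ^ᴴ-closed : ∀ {y} → O y → ∀ n → O (y ^ᴴ n)
      ^ᴴ-closed y∈O zero    = 1∈O
      ^ᴴ-closed y∈O (suc n) = ⊗-closed y∈O (^ᴴ-closed y∈O n)

      D : ℕ
      D = commonDenominator basis

      Nr-hasDenominator-D² : ∀ {x} → O x → HasDenominator (D ℕ.* D) (Nr x)
      Nr-hasDenominator-D² x∈O with Equivalence.to (basis-spans _) x∈O
      ... | c , refl = Nr-hasDenominator (comb-hasDenominator (hasCommonDenominator basis) c)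

      Nr-isInt : ∀ {y} → O y → IsInt (Nr y)
      Nr-isInt {y} y∈O = bounded-denominators-of-powers⇒isInt (D ℕ.* D) {{D²≢0}} (Nr y) λ n →
        subst (HasDenominator (D ℕ.* D)) (Nr-^ᴴ y n) (Nr-hasDenominator-D² (^ᴴ-closed y∈O n))
        where
        D²≢0 : NonZero (D ℕ.* D)
        D²≢0 = ℕ.m*n≢0 D D {{commonDenominator-nonZero basis}} {{commonDenominator-nonZero basis}}

      Tr-isInt : ∀ {y} → O y → IsInt (Tr y)
      Tr-isInt {y} y∈O = subst IsInt (trans (cong (_- (1ℚ + Nr y)) (Nr-oneQ⊕ a b y)) (cancel (Tr y) (Nr y)))
        (isInt-- (Nr-isInt (⊕-closed 1∈O y∈O)) (isInt-+ (+ 1 , refl) (Nr-isInt y∈O)))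
        where
        cancel : ∀ t n → (1ℚ + t + n) - (1ℚ + n) ≡ t
        cancel = solve 2 (λ t n → (con 1ℚ :+ t :+ n) :- (con 1ℚ :+ n) := t) refl

      Nrᵀ-isInt : ∀ {x} → (O ᵀ) x → IsInt (Nr x)
      Nrᵀ-isInt (y , y∈O , refl) = subst IsInt (sym (Nr-ᵀ a b y))
        (isInt-- (isInt-* (+ 4 , refl) (Nr-isInt y∈O)) (isInt-* (Tr-isInt y∈O) (Tr-isInt y∈O)))

    Nr-comb-isInt : ∀ {O n} → IsOrder O → (v : Vec Quat n) → IsBasis (O ᵀ) v → ∀ c → IsInt (Nr (comb c v))
    Nr-comb-isInt isOrder v (v-spans , _) c = Order.Nrᵀ-isInt isOrder (Equivalence.from (v-spans (comb c v)) (c , refl))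

-- Primitive decomposition of coefficient vectors

ℚ-≡-irrelevant : ∀ {p q : ℚ} (e e′ : p ≡ q) → e ≡ e′
ℚ-≡-irrelevant = Decidable⇒UIP.≡-irrelevant ℚ._≟_

cofactor-nonNegative : ∀ m z k .{{_ : NonZero k}} → + k ≡ + m ℤ.* z → ∃ λ q → z ≡ + q × q ℕ.* m ≡ k
cofactor-nonNegative m       (+ q)      k k≡mq =
  q , refl , trans (ℕ.*-comm q m) (sym (ℤ.+-injective (trans k≡mq (sym (ℤ.pos-* m q)))))
cofactor-nonNegative zero    -[1+ _ ]   k k≡0  = ⊥-elim (ℕ.≢-nonZero⁻¹ k (ℤ.+-injective k≡0))
cofactor-nonNegative (suc _) -[1+ _ ]   _ ()

module _ (a b : ℚ) where
  open Algebra a b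

  gcdVec-map-* : ∀ {n} d (c : Vec ℤ n) → gcdVec (map (+ d ℤ.*_) c) ≡ d ℕ.* gcdVec c
  gcdVec-map-* d []       = sym (ℕ.*-zeroʳ d)
  gcdVec-map-* d (x ∷ xs) = begin
    gcd ℤ.∣ + d ℤ.* x ∣ (gcdVec (map (+ d ℤ.*_) xs))  ≡⟨ cong₂ gcd (ℤ.abs-* (+ d) x) (gcdVec-map-* d xs) ⟩
    gcd (d ℕ.* ℤ.∣ x ∣) (d ℕ.* gcdVec xs)             ≡⟨ c*gcd[m,n]≡gcd[cm,cn] d ℤ.∣ x ∣ (gcdVec xs) ⟨
    d ℕ.* gcd ℤ.∣ x ∣ (gcdVec xs)                     ∎
    where open ≡-Reasoning

  ∣gcdVec⇒map-* : ∀ {n g} (c : Vec ℤ n) → g ∣ gcdVec c → ∃ λ c′ → c ≡ map (+ g ℤ.*_) c′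
  ∣gcdVec⇒map-*         []       _     = [] , refl
  ∣gcdVec⇒map-* {g = g} (x ∷ xs) g∣gcd with ℤ∣.∣ᵤ⇒∣ {+ g} {x} (∣-trans g∣gcd (gcd[m,n]∣m ℤ.∣ x ∣ (gcdVec xs)))
                                       | ∣gcdVec⇒map-* xs (∣-trans g∣gcd (gcd[m,n]∣n ℤ.∣ x ∣ (gcdVec xs)))
  ... | ℤ∣.divides y x≡y*g | ys , refl = y ∷ ys , cong (_∷ map (+ g ℤ.*_) ys) (trans x≡y*g (ℤ.*-comm y (+ g)))

  map-*-injective : ∀ {n} d .{{_ : NonZero d}} {c c′ : Vec ℤ n} → map (+ d ℤ.*_) c ≡ map (+ d ℤ.*_) c′ → c ≡ c′
  map-*-injective d {[]}     {[]}       _  = refl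
  map-*-injective d {x ∷ xs} {y ∷ ys} eq with ∷-injective eq
  ... | dx≡dy , dxs≡dys = cong₂ _∷_ (ℤ.*-cancelˡ-≡ (+ d) x y dx≡dy) (map-*-injective d dxs≡dys)

  primitivePart : ∀ {n} (c : Vec ℤ n) .{{_ : NonZero (gcdVec c)}} →
                  ∃ λ c′ → c ≡ map (+ gcdVec c ℤ.*_) c′ × gcdVec c′ ≡ 1
  primitivePart c with ∣gcdVec⇒map-* c ∣-refl
  ... | c′ , c≡gc′ = c′ , c≡gc′ , ℕ.*-cancelˡ-≡ (gcdVec c′) 1 (gcdVec c) (begin
    gcdVec c ℕ.* gcdVec c′             ≡⟨ gcdVec-map-* (gcdVec c) c′ ⟨
    gcdVec (map (+ gcdVec c ℤ.*_) c′)  ≡⟨ cong gcdVec c≡gc′ ⟨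
    gcdVec c                           ≡⟨ ℕ.*-identityʳ (gcdVec c) ⟨
    gcdVec c ℕ.* 1                     ∎)
    where open ≡-Reasoning

  module _ {n} (v : Vec Quat n) (Nr-comb∈ℤ : ∀ c → IsInt (Nr (comb c v))) where

    Nr-comb-map-* : ∀ d c → Nr (comb (map (+ d ℤ.*_) c) v) ≡ ℕtoℚ (d ℕ.* d) * Nr (comb c v)
    Nr-comb-map-* d c = begin
      Nr (comb (map (+ d ℤ.*_) c) v)   ≡⟨ cong Nr (comb-map-* a b (+ d) c v) ⟩
      Nr (ℕtoℚ d · comb c v)           ≡⟨ Nr-· a b (ℕtoℚ d) (comb c v) ⟩
      ℕtoℚ d * ℕtoℚ d * Nr (comb c v)  ≡⟨ cong (_* Nr (comb c v)) (ℕtoℚ-homo-* d d) ⟨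
      ℕtoℚ (d ℕ.* d) * Nr (comb c v)   ∎
      where open ≡-Reasoning

    module _ {k} .{{_ : NonZero k}} where

      gcdVec-nonZero : (s : Sol v k) → NonZero (gcdVec (proj₁ s))
      gcdVec-nonZero (c , Nr≡k) =
        ℕ.≢-nonZero λ g≡0 → ℕ.≢-nonZero⁻¹ k (ℤ.+-injective (ℤtoℚ-injective (Nr≡0 g≡0)))
        where
        Nr≡0 : gcdVec c ≡ 0 → ℕtoℚ k ≡ ℤtoℚ (+ 0)
        Nr≡0 g≡0 with ∣gcdVec⇒map-* c (subst (0 ∣_) (sym g≡0) ∣-refl)
        ... | c′ , c≡0c′ = begin
          ℕtoℚ k                           ≡⟨ Nr≡k ⟨
          Nr (comb c v)                    ≡⟨ cong (λ c → Nr (comb c v)) c≡0c′ ⟩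
          Nr (comb (map (+ 0 ℤ.*_) c′) v)  ≡⟨ Nr-comb-map-* 0 c′ ⟩
          ℕtoℚ 0 * Nr (comb c′ v)          ≡⟨ ℚ.*-zeroˡ (Nr (comb c′ v)) ⟩
          ℤtoℚ (+ 0)                       ∎
          where open ≡-Reasoning

      decompose : Sol v k → SquareDivisorSum (SolPrim v) k
      decompose s@(c , Nr≡k) = g , q , q*g²≡k , c′ , Nr′≡q , proj₂ (proj₂ factorisation)
        where
        g : ℕ
        g = gcdVec c
        factorisation : ∃ λ c′ → c ≡ map (+ g ℤ.*_) c′ × gcdVec c′ ≡ 1
        factorisation = primitivePart c {{gcdVec-nonZero s}}
        c′ : Vec ℤ n
        c′ = proj₁ factorisation
        z : ℤ
        z = proj₁ (Nr-comb∈ℤ c′)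
        k≡g²z : + k ≡ + (g ℕ.* g) ℤ.* z
        k≡g²z = ℤtoℚ-injective (begin
          ℕtoℚ k                           ≡⟨ Nr≡k ⟨
          Nr (comb c v)                    ≡⟨ cong (λ c → Nr (comb c v)) (proj₁ (proj₂ factorisation)) ⟩
          Nr (comb (map (+ g ℤ.*_) c′) v)  ≡⟨ Nr-comb-map-* g c′ ⟩
          ℕtoℚ (g ℕ.* g) * Nr (comb c′ v)  ≡⟨ cong (ℕtoℚ (g ℕ.* g) *_) (proj₂ (Nr-comb∈ℤ c′)) ⟩
          ℕtoℚ (g ℕ.* g) * ℤtoℚ z          ≡⟨ ℤtoℚ-homo-* (+ (g ℕ.* g)) z ⟨
          ℤtoℚ (+ (g ℕ.* g) ℤ.* z)         ∎)
          where open ≡-Reasoning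
        cofactor : ∃ λ q → z ≡ + q × q ℕ.* (g ℕ.* g) ≡ k
        cofactor = cofactor-nonNegative (g ℕ.* g) z k k≡g²z
        q : ℕ
        q = proj₁ cofactor
        q*g²≡k : q ℕ.* (g ℕ.* g) ≡ k
        q*g²≡k = proj₂ (proj₂ cofactor)
        Nr′≡q : Nr (comb c′ v) ≡ ℕtoℚ q
        Nr′≡q = trans (proj₂ (Nr-comb∈ℤ c′)) (cong ℤtoℚ (proj₁ (proj₂ cofactor)))

      recompose : SquareDivisorSum (SolPrim v) k → Sol v k
      recompose (d , q , q*d²≡k , c′ , Nr′≡q , _) = map (+ d ℤ.*_) c′ , (begin
        Nr (comb (map (+ d ℤ.*_) c′) v)  ≡⟨ Nr-comb-map-* d c′ ⟩
        ℕtoℚ (d ℕ.* d) * Nr (comb c′ v)  ≡⟨ cong (ℕtoℚ (d ℕ.* d) *_) Nr′≡q ⟩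
        ℕtoℚ (d ℕ.* d) * ℕtoℚ q          ≡⟨ ℕtoℚ-homo-* (d ℕ.* d) q ⟨
        ℕtoℚ (d ℕ.* d ℕ.* q)             ≡⟨ cong ℕtoℚ (trans (ℕ.*-comm (d ℕ.* d) q) q*d²≡k) ⟩
        ℕtoℚ k                           ∎)
        where open ≡-Reasoning

      Sol-≡ : ∀ {c c′ p p′} → c ≡ c′ → _≡_ {A = Sol v k} (c , p) (c′ , p′)
      Sol-≡ {p = p} {p′} refl = cong (_ ,_) (ℚ-≡-irrelevant p p′)

      SquareDivisorSum-≡ : ∀ {d d′ q q′ e e′ c c′ nr nr′ p p′} → d ≡ d′ → q ≡ q′ → c ≡ c′ →
        _≡_ {A = SquareDivisorSum (SolPrim v) k} (d , q , e , c , nr , p) (d′ , q′ , e′ , c′ , nr′ , p′)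
      SquareDivisorSum-≡ {e = e} {e′} {nr = nr} {nr′} {p = p} {p′} refl refl refl
        rewrite ℕ.≡-irrelevant e e′ | ℚ-≡-irrelevant nr nr′ | ℕ.≡-irrelevant p p′ = refl

      recompose∘decompose : ∀ s → recompose (decompose s) ≡ s
      recompose∘decompose s@(c , _) = Sol-≡ (sym (proj₁ (proj₂ (primitivePart c {{gcdVec-nonZero s}}))))

      decompose∘recompose : ∀ t → decompose (recompose t) ≡ t
      decompose∘recompose t@(d , q , q*d²≡k , c′ , _ , gcd′≡1) = SquareDivisorSum-≡ g≡d q″≡q c″≡c′
        where
        s : Sol v k
        s = recompose t
        g≡d : gcdVec (map (+ d ℤ.*_) c′) ≡ d
        g≡d = trans (gcdVec-map-* d c′) (trans (cong (d ℕ.*_) gcd′≡1) (ℕ.*-identityʳ d))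
        instance
          d≢0 : NonZero d
          d≢0 = subst NonZero g≡d (gcdVec-nonZero s)
        factorisation : ∃ λ c″ → map (+ d ℤ.*_) c′ ≡ map (+ gcdVec (map (+ d ℤ.*_) c′) ℤ.*_) c″ × gcdVec c″ ≡ 1
        factorisation = primitivePart (map (+ d ℤ.*_) c′) {{gcdVec-nonZero s}}
        c″≡c′ : proj₁ factorisation ≡ c′
        c″≡c′ = sym (map-*-injective d (subst (λ g → map (+ d ℤ.*_) c′ ≡ map (+ g ℤ.*_) (proj₁ factorisation))
                                              g≡d (proj₁ (proj₂ factorisation))))
        q″ : ℕ
        q″ = proj₁ (proj₂ (decompose s))
        q″≡q : q″ ≡ q
        q″≡q = ℕ.*-cancelʳ-≡ q″ q (d ℕ.* d) {{ℕ.m*n≢0 d d}}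
          (trans (subst (λ g → q″ ℕ.* (g ℕ.* g) ≡ k) g≡d (proj₁ (proj₂ (proj₂ (decompose s))))) (sym q*d²≡k))

      Sol↔SquareDivisorSum : Sol v k ↔ SquareDivisorSum (SolPrim v) k
      Sol↔SquareDivisorSum = mk↔ₛ′ decompose recompose decompose∘recompose recompose∘decompose

presentation-isInt : ∀ {p a b} → BpPresentation p a b → IsInt a × IsInt b
presentation-isInt     (case2 _)             = isInt-neg (+ 1 , refl) , isInt-neg (+ 1 , refl)
presentation-isInt {p} (case3mod4 _)         = isInt-neg (+ 1 , refl) , isInt-neg (+ p , refl)
presentation-isInt {p} (case5mod8 _)         = isInt-neg (+ 2 , refl) , isInt-neg (+ p , refl)
presentation-isInt {p} (case1mod8 _ q _ _ _) = isInt-neg (+ p , refl) , isInt-neg (+ q , refl)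

lemma5p4 : (p : ℕ) → Prime p → (a b : ℚ) → BpPresentation p a b →
    let open Algebra a b in
    (O O' : Quat → Set) → IsMaximalOrder O → IsMaximalOrder O' →
    (v v' : Vec Quat 3) → IsBasis (O ᵀ) v → IsBasis (O' ᵀ) v' →
    (bd : ℕ) → 1 ≤ bd →
    ((∀ k → 1 ≤ k → k ≤ bd → θEq v v' k) → (∀ k → 1 ≤ k → k ≤ bd → θ'Eq v v' k)) ×
    ((∀ k → 1 ≤ k → k ≤ bd → θ'Eq v v' k) → (∀ k → 1 ≤ k → k ≤ bd → θEq v v' k))
lemma5p4 _ _ a b presentation _ _ (O-isOrder , _) (O′-isOrder , _) v v′ v-basis v′-basis bd _ =
  EqualCount-inversion {c = 2} (decomposition O-isOrder v v-basis) (decomposition O′-isOrder v′ v′-basis) bd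
  where
  open Algebra a b
  decomposition : ∀ {O} → IsOrder O → (w : Vec Quat 3) → IsBasis (O ᵀ) w →
                  ∀ k → 1 ≤ k → Sol w k ↔ SquareDivisorSum (SolPrim w) k
  decomposition isOrder w w-basis k 1≤k with presentation-isInt presentation
  ... | a∈ℤ , b∈ℤ = Sol↔SquareDivisorSum a b w (Nr-comb-isInt a b a∈ℤ b∈ℤ isOrder w w-basis) {{ℕ.>-nonZero 1≤k}}
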